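{- Let $M$ be a rank-$3$ inseparable matroid, and suppose $F$ and $L$ are rank-$2$ flats of $M$ with $F\cap L\neq\emptyset$ and $F\cup L=E(M)$. Then $M$ is not hypermodular.
   Context: A matroid is inseparable (connected) if it has no nontrivial separator. A pair of flats $\{A,B\}$ is modular if $r(A\cup B)+r(A\cap B)=r(A)+r(B)$. A matroid of rank $k\ge3$ is hypermodular if every pair of two flats of rank $k-1$ is a modular pair. -}

module Defs where

open import Data.Nat using (ℕ; _+_; _≤_; _<_)
open import Data.Fin using (Fin)
open import Data.Fin.Subset using (Subset; _∪_; _∩_; _⊆_; ∁; ⁅_⁆; _∈_; _∉_; ∣_∣; ⊥; ⊤; Nonempty)
open import Relation.Binary.PropositionalEquality using (_≡_)
open import Relation.Nullary using (¬_)
open import Data.Product using (_×_)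

record Matroid (n : ℕ) : Set where
  field
    r          : Subset n → ℕ
    r-bounded  : ∀ X → r X ≤ ∣ X ∣
    r-mono     : ∀ {X Y} → X ⊆ Y → r X ≤ r Y
    r-submod   : ∀ X Y → r (X ∪ Y) + r (X ∩ Y) ≤ r X + r Y

module _ {n : ℕ} (M : Matroid n) where
  open Matroid M

  rank : ℕ
  rank = r ⊤

  IsFlat : Subset n → Set
  IsFlat X = ∀ e → e ∉ X → r X < r (X ∪ ⁅ e ⁆)

  IsSeparator : Subset n → Set
  IsSeparator S = r S + r (∁ S) ≡ r ⊤

  IsNontrivialSeparator : Subset n → Set
  IsNontrivialSeparator S = IsSeparator S × ¬ (S ≡ ⊥) × ¬ (S ≡ ⊤)

  Inseparable : Set
  Inseparable = ∀ S → ¬ IsNontrivialSeparator S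

  ModularPair : Subset n → Subset n → Set
  ModularPair A B = r (A ∪ B) + r (A ∩ B) ≡ r A + r B

  Hypermodular : Set
  Hypermodular = 3 ≤ rank × (∀ A B → IsFlat A → IsFlat B →
                   r A + 1 ≡ rank → r B + 1 ≡ rank → ModularPair A B)

-- Inseparability gives points a, a′ ∈ F − L with r{a,a′} = 2 and b, b′ ∈ L − F
-- with r{b,b′} = 2. Modularity of lines in a hypermodular plane makes the lines
-- H = cl{a,b} and H′ = cl{a′,b′} meet in a non-loop x, and makes each of H ∩ F,
-- H′ ∩ F, H ∩ L, H′ ∩ L of rank at most 1. If x ∈ F then a, x, a′ are pairwise
-- parallel, contradicting r{a,a′} = 2; if x ∈ L the same happens to b, x, b′.

module Submission where

open import Defs
open import Data.Nat using (ℕ; _+_; _≤_; _<_; z≤n; s≤s; _≤?_; _<?_)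
open import Data.Nat.Properties
open import Data.Bool.Properties using (T-≡)
open import Data.Fin using (Fin)
open import Data.Fin.Subset
  using (Subset; _∪_; _∩_; ⊤; ⊥; ∁; ⁅_⁆; _∈_; _∉_; _⊆_; ⋃; Nonempty)
open import Data.Fin.Subset.Properties
open import Data.Fin.Properties using (any?)
open import Data.Vec using (lookup; tabulate)
open import Data.Vec.Properties using ([]=⇒lookup; lookup⇒[]=; lookup∘tabulate)
open import Data.List using (List; []; _∷_; map; filter; allFin)
open import Data.List.Relation.Unary.Any using (here; there)
import Data.List.Membership.Propositional as List
open import Data.List.Membership.Propositional.Properties
  using (∈-filter⁺; ∈-filter⁻; ∈-allFin)
open import Data.Product using (_×_; _,_; proj₂; ∃; ∃₂)
open import Data.Sum using (_⊎_; inj₁; inj₂; [_,_])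
open import Function.Bundles using (Equivalence)
open import Relation.Nullary using (¬_; Dec; yes; no; contradiction)
open import Relation.Nullary.Decidable using (isYes; _×-dec_; toWitness; fromWitness)
open import Relation.Binary.PropositionalEquality
  using (_≡_; _≢_; refl; sym; trans; cong; cong₂; subst; subst₂)

private
  variable
    n : ℕ
    x y : Fin n
    p q s : Subset n

⁅⁆⊆ : x ∈ p → ⁅ x ⁆ ⊆ p
⁅⁆⊆ {x = x} {p} x∈p y∈⁅x⁆ = subst (_∈ p) (sym (x∈⁅y⁆⇒x≡y x y∈⁅x⁆)) x∈p

∪-least : p ⊆ s → q ⊆ s → p ∪ q ⊆ s
∪-least {p = p} {q = q} p⊆s q⊆s x∈p∪q = [ p⊆s , q⊆s ] (x∈p∪q⁻ p q x∈p∪q)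

∩-greatest : s ⊆ p → s ⊆ q → s ⊆ p ∩ q
∩-greatest s⊆p s⊆q x∈s = x∈p∩q⁺ (s⊆p x∈s , s⊆q x∈s)

∪-monoˡ-⊆ : p ⊆ q → p ∪ s ⊆ q ∪ s
∪-monoˡ-⊆ {s = s} p⊆q = ∪-least (⊆-trans p⊆q (p⊆p∪q s)) (q⊆p∪q _ s)

∪-monoʳ-⊆ : p ⊆ q → s ∪ p ⊆ s ∪ q
∪-monoʳ-⊆ {s = s} p⊆q = ∪-least (p⊆p∪q _) (⊆-trans p⊆q (q⊆p∪q s _))

pair⊆ : x ∈ p → y ∈ p → ⁅ x ⁆ ∪ ⁅ y ⁆ ⊆ p
pair⊆ x∈p y∈p = ∪-least (⁅⁆⊆ x∈p) (⁅⁆⊆ y∈p)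

∈-⋃-singletons : ∀ {xs : List (Fin n)} → x List.∈ xs → x ∈ ⋃ (map ⁅_⁆ xs)
∈-⋃-singletons {x = x} (here refl) = p⊆p∪q _ (x∈⁅x⁆ x)
∈-⋃-singletons (there x∈xs)        = q⊆p∪q _ _ (∈-⋃-singletons x∈xs)

module MatroidProperties {n : ℕ} (M : Matroid n) where
  open Matroid M

  r-⊥ : r ⊥ ≡ 0
  r-⊥ = n≤0⇒n≡0 (subst (r ⊥ ≤_) (∣⊥∣≡0 n) (r-bounded ⊥))

  r-⁅⁆≤1 : ∀ e → r ⁅ e ⁆ ≤ 1
  r-⁅⁆≤1 e = subst (r ⁅ e ⁆ ≤_) (∣⁅x⁆∣≡1 e) (r-bounded ⁅ e ⁆)

  r-subadditive : ∀ X Y → r (X ∪ Y) ≤ r X + r Y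
  r-subadditive X Y = ≤-trans (m≤m+n _ _) (r-submod X Y)

  Spans : Subset n → Subset n → Set
  Spans Y X = r (Y ∪ X) ≤ r Y

  spans-∪ : ∀ {Y A B} → Spans Y A → Spans Y B → Spans Y (A ∪ B)
  spans-∪ {Y} {A} {B} Y-spans-A Y-spans-B = +-cancelʳ-≤ (r Y) _ _ (begin
      r (Y ∪ (A ∪ B)) + r Y  ≤⟨ +-mono-≤ (r-mono ⊆P∪Q) (r-mono ⊆P∩Q) ⟩
      r (P ∪ Q) + r (P ∩ Q)  ≤⟨ r-submod P Q ⟩
      r P + r Q              ≤⟨ +-mono-≤ Y-spans-A Y-spans-B ⟩
      r Y + r Y              ∎)
    where
    open ≤-Reasoning
    P = Y ∪ A
    Q = Y ∪ B
    ⊆P∪Q : Y ∪ (A ∪ B) ⊆ P ∪ Q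
    ⊆P∪Q = ∪-least (⊆-trans (p⊆p∪q A) (p⊆p∪q Q))
             (∪-least (⊆-trans (q⊆p∪q Y A) (p⊆p∪q Q))
                      (⊆-trans (q⊆p∪q Y B) (q⊆p∪q P Q)))
    ⊆P∩Q : Y ⊆ P ∩ Q
    ⊆P∩Q = ∩-greatest (p⊆p∪q A) (p⊆p∪q B)

  spans-⋃-singletons : ∀ {Y} xs → (∀ {x} → x List.∈ xs → Spans Y ⁅ x ⁆) →
                       Spans Y (⋃ (map ⁅_⁆ xs))
  spans-⋃-singletons {Y} []       _    = ≤-reflexive (cong r (∪-identityʳ Y))
  spans-⋃-singletons      (x ∷ xs) span =
    spans-∪ (span (here refl)) (spans-⋃-singletons xs (λ x∈xs → span (there x∈xs)))

  spans-elementwise : ∀ {Y S} → (∀ {e} → e ∈ S → Spans Y ⁅ e ⁆) → Spans Y S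
  spans-elementwise {Y} {S} span =
    ≤-trans (r-mono (∪-monoʳ-⊆ S⊆⋃))
            (spans-⋃-singletons members λ e∈members →
              span (proj₂ (∈-filter⁻ (_∈? S) {xs = allFin n} e∈members)))
    where
    members : List (Fin n)
    members = filter (_∈? S) (allFin n)
    S⊆⋃ : S ⊆ ⋃ (map ⁅_⁆ members)
    S⊆⋃ {e} e∈S = ∈-⋃-singletons (∈-filter⁺ (_∈? S) (∈-allFin e) e∈S)

  rank-increasing-element : ∀ Y X → r Y < r (Y ∪ X) →
                            ∃ λ e → e ∈ X × r Y < r (Y ∪ ⁅ e ⁆)
  rank-increasing-element Y X r<
    with any? (λ e → (e ∈? X) ×-dec (r Y <? r (Y ∪ ⁅ e ⁆)))
  ... | yes witness = witness
  ... | no ∄witness = contradiction Y-spans-X (<⇒≱ r<)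
    where
    Y-spans-X : Spans Y X
    Y-spans-X = spans-elementwise λ {e} e∈X → ≮⇒≥ λ r<′ → ∄witness (e , e∈X , r<′)

  positive-rank⇒nonloop : ∀ X → 1 ≤ r X → ∃ λ e → e ∈ X × 1 ≤ r ⁅ e ⁆
  positive-rank⇒nonloop X 1≤rX
    with rank-increasing-element ⊥ X
           (subst₂ _<_ (sym r-⊥) (cong r (sym (∪-identityˡ X))) 1≤rX)
  ... | e , e∈X , r< = e , e∈X , subst₂ _<_ r-⊥ (cong r (∪-identityˡ ⁅ e ⁆)) r<

  rank≥2⇒independent-pair : ∀ X → 2 ≤ r X →
                            ∃₂ λ e e′ → e ∈ X × e′ ∈ X × 2 ≤ r (⁅ e ⁆ ∪ ⁅ e′ ⁆)
  rank≥2⇒independent-pair X 2≤rX with positive-rank⇒nonloop X (≤-trans (s≤s z≤n) 2≤rX)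
  ... | e , e∈X , 1≤re with rank-increasing-element ⁅ e ⁆ X
        (≤-trans (s≤s (r-⁅⁆≤1 e)) (≤-trans 2≤rX (r-mono (q⊆p∪q ⁅ e ⁆ X))))
  ... | e′ , e′∈X , r< = e , e′ , e∈X , e′∈X , ≤-trans (s≤s 1≤re) r<

  parallel-trans : ∀ {u v x} → 1 ≤ r ⁅ x ⁆ →
                   r (⁅ u ⁆ ∪ ⁅ x ⁆) ≤ 1 → r (⁅ x ⁆ ∪ ⁅ v ⁆) ≤ 1 → r (⁅ u ⁆ ∪ ⁅ v ⁆) ≤ 1
  parallel-trans {u} {v} {x} 1≤rx ux vx = +-cancelʳ-≤ 1 _ 1 (begin
      r (⁅ u ⁆ ∪ ⁅ v ⁆) + 1  ≤⟨ +-mono-≤ (r-mono ⊆A∪B) (≤-trans 1≤rx (r-mono ⊆A∩B)) ⟩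
      r (A ∪ B) + r (A ∩ B)  ≤⟨ r-submod A B ⟩
      r A + r B              ≤⟨ +-mono-≤ ux vx ⟩
      1 + 1                  ∎)
    where
    open ≤-Reasoning
    A = ⁅ u ⁆ ∪ ⁅ x ⁆
    B = ⁅ x ⁆ ∪ ⁅ v ⁆
    ⊆A∪B : ⁅ u ⁆ ∪ ⁅ v ⁆ ⊆ A ∪ B
    ⊆A∪B = ∪-least (⊆-trans (p⊆p∪q ⁅ x ⁆) (p⊆p∪q B))
                   (⊆-trans (q⊆p∪q ⁅ x ⁆ ⁅ v ⁆) (q⊆p∪q A B))
    ⊆A∩B : ⁅ x ⁆ ⊆ A ∩ B
    ⊆A∩B = ∩-greatest (q⊆p∪q ⁅ u ⁆ ⁅ x ⁆) (p⊆p∪q ⁅ v ⁆)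

  flat-∩-< : ∀ {F Z v} → IsFlat M F → v ∉ F → v ∈ Z → r (F ∩ Z) < r Z
  flat-∩-< {F} {Z} {v} F-flat v∉F v∈Z = +-cancelˡ-< (r F) _ _ (begin-strict
      r F + r (F ∩ Z)            <⟨ +-monoˡ-< (r (F ∩ Z)) (F-flat v v∉F) ⟩
      r (F ∪ ⁅ v ⁆) + r (F ∩ Z)  ≤⟨ +-monoˡ-≤ (r (F ∩ Z)) (r-mono (∪-monoʳ-⊆ (⁅⁆⊆ v∈Z))) ⟩
      r (F ∪ Z) + r (F ∩ Z)      ≤⟨ r-submod F Z ⟩
      r F + r Z                  ∎)
    where open ≤-Reasoning

  ∉-flat⇒nonloop : ∀ {F v} → IsFlat M F → v ∉ F → 1 ≤ r ⁅ v ⁆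
  ∉-flat⇒nonloop {v = v} F-flat v∉F =
    ≤-trans (s≤s z≤n) (flat-∩-< F-flat v∉F (x∈⁅x⁆ v))

  r-pair≡2 : ∀ {F u v} → IsFlat M F → u ∈ F → 1 ≤ r ⁅ u ⁆ → v ∉ F →
             r (⁅ u ⁆ ∪ ⁅ v ⁆) ≡ 2
  r-pair≡2 {F} {u} {v} F-flat u∈F 1≤ru v∉F = ≤-antisym
    (≤-trans (r-subadditive ⁅ u ⁆ ⁅ v ⁆) (+-mono-≤ (r-⁅⁆≤1 u) (r-⁅⁆≤1 v)))
    (≤-trans (s≤s (≤-trans 1≤ru (r-mono (∩-greatest (⁅⁆⊆ u∈F) (p⊆p∪q ⁅ v ⁆)))))
             (flat-∩-< F-flat v∉F (q⊆p∪q ⁅ u ⁆ ⁅ v ⁆ (x∈⁅x⁆ v))))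

  spans? : ∀ Y X → Dec (Spans Y X)
  spans? Y X = r (Y ∪ X) ≤? r Y

  cl : Subset n → Subset n
  cl Y = tabulate λ e → isYes (spans? Y ⁅ e ⁆)

  lookup-cl : ∀ Y e → lookup (cl Y) e ≡ isYes (spans? Y ⁅ e ⁆)
  lookup-cl Y = lookup∘tabulate λ e → isYes (spans? Y ⁅ e ⁆)

  ∈-cl⁻ : ∀ {Y e} → e ∈ cl Y → Spans Y ⁅ e ⁆
  ∈-cl⁻ {Y} {e} e∈clY =
    toWitness (Equivalence.from T-≡ (trans (sym (lookup-cl Y e)) ([]=⇒lookup e∈clY)))

  ∈-cl⁺ : ∀ {Y e} → Spans Y ⁅ e ⁆ → e ∈ cl Y
  ∈-cl⁺ {Y} {e} span =
    lookup⇒[]= e (cl Y) (trans (lookup-cl Y e) (Equivalence.to T-≡ (fromWitness span)))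

  ⊆-cl : ∀ Y → Y ⊆ cl Y
  ⊆-cl Y e∈Y = ∈-cl⁺ (r-mono (∪-least ⊆-refl (⁅⁆⊆ e∈Y)))

  r-cl : ∀ Y → r (cl Y) ≡ r Y
  r-cl Y = ≤-antisym (≤-trans (r-mono (q⊆p∪q Y (cl Y))) (spans-elementwise ∈-cl⁻))
                     (r-mono (⊆-cl Y))

  cl-isFlat : ∀ Y → IsFlat M (cl Y)
  cl-isFlat Y e e∉clY = begin-strict
    r (cl Y)          ≡⟨ r-cl Y ⟩
    r Y               <⟨ ≰⇒> (λ span → e∉clY (∈-cl⁺ span)) ⟩
    r (Y ∪ ⁅ e ⁆)     ≤⟨ r-mono (∪-monoˡ-⊆ (⊆-cl Y)) ⟩
    r (cl Y ∪ ⁅ e ⁆)  ∎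
    where open ≤-Reasoning

  IsLine : Subset n → Set
  IsLine X = IsFlat M X × r X ≡ 2

  line-through : ∀ {F u v} → IsFlat M F → u ∈ F → 1 ≤ r ⁅ u ⁆ → v ∉ F →
                 IsLine (cl (⁅ u ⁆ ∪ ⁅ v ⁆))
  line-through F-flat u∈F 1≤ru v∉F =
    cl-isFlat _ , trans (r-cl _) (r-pair≡2 F-flat u∈F 1≤ru v∉F)

  inseparable⇒r⊤<r+r∁ : Inseparable M → ∀ {X} → X ≢ ⊥ → X ≢ ⊤ → r ⊤ < r X + r (∁ X)
  inseparable⇒r⊤<r+r∁ insep {X} X≢⊥ X≢⊤ = ≤∧≢⇒<
    (subst (λ S → r S ≤ r X + r (∁ X)) (p∪∁p≡⊤ X) (r-subadditive X (∁ X)))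
    (λ r⊤≡ → insep X (sym r⊤≡ , X≢⊥ , X≢⊤))

  IndependentPairOutside : Subset n → Set
  IndependentPairOutside X = ∃₂ λ e e′ → e ∉ X × e′ ∉ X × 2 ≤ r (⁅ e ⁆ ∪ ⁅ e′ ⁆)

  module Plane (r⊤≡3 : r ⊤ ≡ 3) where

    line-complement-rank≥2 : Inseparable M → ∀ {X} → IsLine X → 2 ≤ r (∁ X)
    line-complement-rank≥2 insep {X} (_ , rX≡2) = +-cancelˡ-≤ 2 2 (r (∁ X))
      (subst₂ _<_ r⊤≡3 (cong (_+ r (∁ X)) rX≡2) (inseparable⇒r⊤<r+r∁ insep X≢⊥ X≢⊤))
      where
      X≢⊥ : X ≢ ⊥
      X≢⊥ X≡⊥ = contradiction (trans (sym rX≡2) (trans (cong r X≡⊥) r-⊥)) λ ()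
      X≢⊤ : X ≢ ⊤
      X≢⊤ X≡⊤ = contradiction (trans (sym rX≡2) (trans (cong r X≡⊤) r⊤≡3)) λ ()

    independent-pair-outside-line : Inseparable M → ∀ {X} → IsLine X → IndependentPairOutside X
    independent-pair-outside-line insep X-line
      with rank≥2⇒independent-pair _ (line-complement-rank≥2 insep X-line)
    ... | e , e′ , e∈∁X , e′∈∁X , 2≤ree′ =
      e , e′ , x∈∁p⇒x∉p e∈∁X , x∈∁p⇒x∉p e′∈∁X , 2≤ree′

    module Hypermodularity (hypermodular : Hypermodular M) where

      lines-modular : ∀ {A B} → IsLine A → IsLine B → r (A ∪ B) + r (A ∩ B) ≡ 4
      lines-modular {A} {B} (A-flat , rA≡2) (B-flat , rB≡2) =
        trans (proj₂ hypermodular A B A-flat B-flat (hyperplane rA≡2) (hyperplane rB≡2))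
              (cong₂ _+_ rA≡2 rB≡2)
        where
        hyperplane : ∀ {X} → r X ≡ 2 → r X + 1 ≡ rank M
        hyperplane rX≡2 = trans (cong (_+ 1) rX≡2) (sym r⊤≡3)

      lines-meet : ∀ {A B} → IsLine A → IsLine B → 1 ≤ r (A ∩ B)
      lines-meet {A} {B} A-line B-line = +-cancelˡ-≤ 3 1 (r (A ∩ B)) (begin
        4                      ≡⟨ lines-modular A-line B-line ⟨
        r (A ∪ B) + r (A ∩ B)  ≤⟨ +-monoˡ-≤ (r (A ∩ B)) rA∪B≤3 ⟩
        3 + r (A ∩ B)          ∎)
        where
        open ≤-Reasoning
        rA∪B≤3 : r (A ∪ B) ≤ 3
        rA∪B≤3 = subst (r (A ∪ B) ≤_) r⊤≡3 (r-mono ⊆⊤)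

      distinct-lines-meet-in-point : ∀ {A B v} → IsLine A → IsLine B → v ∈ A → v ∉ B →
                                     r (A ∩ B) ≤ 1
      distinct-lines-meet-in-point {A} {B} A-line B-line@(B-flat , rB≡2) v∈A v∉B =
        +-cancelˡ-≤ 3 (r (A ∩ B)) 1 (begin
          3 + r (A ∩ B)          ≤⟨ +-monoˡ-≤ (r (A ∩ B)) 3≤rA∪B ⟩
          r (A ∪ B) + r (A ∩ B)  ≡⟨ lines-modular A-line B-line ⟩
          4                      ∎)
        where
        open ≤-Reasoning
        2≤rB∩A∪B : 2 ≤ r (B ∩ (A ∪ B))
        2≤rB∩A∪B = subst (_≤ r (B ∩ (A ∪ B))) rB≡2 (r-mono (∩-greatest ⊆-refl (q⊆p∪q A B)))
        3≤rA∪B : 3 ≤ r (A ∪ B)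
        3≤rA∪B = ≤-trans (s≤s 2≤rB∩A∪B) (flat-∩-< B-flat v∉B (p⊆p∪q B v∈A))

      parallel-in-meet : ∀ {A B u v w} → IsLine A → IsLine B → v ∈ A → v ∉ B →
                         u ∈ A → u ∈ B → w ∈ A → w ∈ B → r (⁅ u ⁆ ∪ ⁅ w ⁆) ≤ 1
      parallel-in-meet A-line B-line v∈A v∉B u∈A u∈B w∈A w∈B =
        ≤-trans (r-mono (pair⊆ (x∈p∩q⁺ (u∈A , u∈B)) (x∈p∩q⁺ (w∈A , w∈B))))
                (distinct-lines-meet-in-point A-line B-line v∈A v∉B)

    no-covering-pair-of-lines : ∀ {F L} → IsLine F → IsLine L → (∀ x → x ∈ F ⊎ x ∈ L) →
                                IndependentPairOutside L → IndependentPairOutside F →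
                                ¬ Hypermodular M
    no-covering-pair-of-lines {F} {L} F-line@(F-flat , _) L-line@(L-flat , _) covered
      (a , a′ , a∉L , a′∉L , 2≤raa′) (b , b′ , b∉F , b′∉F , 2≤rbb′) hypermodular =
      meet-point (positive-rank⇒nonloop (H ∩ H′) (lines-meet H-line H′-line))
      where
      open Hypermodularity hypermodular
      ∉L⇒∈F : ∀ {x} → x ∉ L → x ∈ F
      ∉L⇒∈F {x} x∉L = [ (λ x∈F → x∈F) , (λ x∈L → contradiction x∈L x∉L) ] (covered x)
      ∉F⇒∈L : ∀ {x} → x ∉ F → x ∈ L
      ∉F⇒∈L {x} x∉F = [ (λ x∈F → contradiction x∈F x∉F) , (λ x∈L → x∈L) ] (covered x)
      H H′ : Subset n
      H  = cl (⁅ a ⁆ ∪ ⁅ b ⁆)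
      H′ = cl (⁅ a′ ⁆ ∪ ⁅ b′ ⁆)
      H-line : IsLine H
      H-line = line-through F-flat (∉L⇒∈F a∉L) (∉-flat⇒nonloop L-flat a∉L) b∉F
      H′-line : IsLine H′
      H′-line = line-through F-flat (∉L⇒∈F a′∉L) (∉-flat⇒nonloop L-flat a′∉L) b′∉F
      a∈H : a ∈ H
      a∈H = ⊆-cl _ (p⊆p∪q ⁅ b ⁆ (x∈⁅x⁆ a))
      b∈H : b ∈ H
      b∈H = ⊆-cl _ (q⊆p∪q ⁅ a ⁆ ⁅ b ⁆ (x∈⁅x⁆ b))
      a′∈H′ : a′ ∈ H′
      a′∈H′ = ⊆-cl _ (p⊆p∪q ⁅ b′ ⁆ (x∈⁅x⁆ a′))
      b′∈H′ : b′ ∈ H′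
      b′∈H′ = ⊆-cl _ (q⊆p∪q ⁅ a′ ⁆ ⁅ b′ ⁆ (x∈⁅x⁆ b′))
      meet-point : ¬ (∃ λ x → x ∈ H ∩ H′ × 1 ≤ r ⁅ x ⁆)
      meet-point (x , x∈H∩H′ , 1≤rx) with x∈p∩q⁻ H H′ x∈H∩H′ | covered x
      ... | x∈H , x∈H′ | inj₁ x∈F = <⇒≱ 2≤raa′ (parallel-trans 1≤rx
        (parallel-in-meet H-line F-line b∈H b∉F a∈H (∉L⇒∈F a∉L) x∈H x∈F)
        (parallel-in-meet H′-line F-line b′∈H′ b′∉F x∈H′ x∈F a′∈H′ (∉L⇒∈F a′∉L)))
      ... | x∈H , x∈H′ | inj₂ x∈L = <⇒≱ 2≤rbb′ (parallel-trans 1≤rx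
        (parallel-in-meet H-line L-line a∈H a∉L b∈H (∉F⇒∈L b∉F) x∈H x∈L)
        (parallel-in-meet H′-line L-line a′∈H′ a′∉L x∈H′ x∈L b′∈H′ (∉F⇒∈L b′∉F)))

corollary2p11 : {n : ℕ} (M : Matroid n) → rank M ≡ 3 → Inseparable M →
                (F L : Subset n) → IsFlat M F → IsFlat M L →
                Matroid.r M F ≡ 2 → Matroid.r M L ≡ 2 →
                Nonempty (F ∩ L) → F ∪ L ≡ ⊤ →
                ¬ Hypermodular M
corollary2p11 M r⊤≡3 insep F L F-flat L-flat rF≡2 rL≡2 _ F∪L≡⊤ =
  no-covering-pair-of-lines F-line L-line covered
    (independent-pair-outside-line insep L-line) (independent-pair-outside-line insep F-line)
  where
  open MatroidProperties M
  open Plane r⊤≡3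
  F-line : IsLine F
  F-line = F-flat , rF≡2
  L-line : IsLine L
  L-line = L-flat , rL≡2
  covered : ∀ x → x ∈ F ⊎ x ∈ L
  covered x = x∈p∪q⁻ F L (subst (x ∈_) (sym F∪L≡⊤) ∈⊤)
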